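{- There exists $\alpha>0$ such that $f(k)\ge \alpha\sqrt k$ for all sufficiently large $k$; in particular, $\alpha=0.7$ suffices.
   Context: $Q_k$ is the hypercube graph on $\{0,1\}^k$ (edges between vertices differing in exactly one coordinate); $\bar u$ is the vertex obtained from $u$ by complementing all coordinates; a geodesic is a shortest path. The number of color changes of a path is the number of internal vertices of the path whose two path-edges have different colors. For a $2$-coloring $c$ of the edges of $Q_k$ and a vertex $u$, let $s_{c,u,\bar u}$ be the minimum number of color changes over all geodesics from $u$ to $\bar u$. Define $f(k)=\max_c \frac{1}{2^k}\sum_{u\in V(Q_k)} s_{c,u,\bar u}$, the maximum over all $2$-colorings $c$ of the edges of $Q_k$. -}

module Defs where

open import Data.Bool using (Bool; true; false; not; _xor_; if_then_else_)
open import Data.Nat using (ℕ; zero; suc; _+_; _≤_)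
open import Data.Fin using (Fin)
open import Data.Vec using (Vec; []; _∷_; updateAt; map)
open import Data.List using (List; []; _∷_; length)
open import Data.Product using (Σ; _×_; Σ-syntax; proj₁)
open import Relation.Binary.PropositionalEquality using (_≡_)

Vertex : ℕ → Set
Vertex k = Vec Bool k

flipAt : ∀ {k} → Vertex k → Fin k → Vertex k
flipAt u i = updateAt u i not

complement : ∀ {k} → Vertex k → Vertex k
complement = map not

-- A 2-colouring of the edges of Q_k: every edge is {u , flipAt u i} and is
-- named by (u , i) and by (flipAt u i , i); the colour must agree on both names.
Coloring : ℕ → Set
Coloring k = Σ (Vertex k → Fin k → Bool)
               (λ c → ∀ (u : Vertex k) (i : Fin k) → c (flipAt u i) i ≡ c u i)

colour : ∀ {k} → Coloring k → Vertex k → Fin k → Bool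
colour = proj₁

-- A walk in Q_k is a start vertex together with the list of coordinates
-- flipped at each step.  endpoint u ds is the last vertex of the walk.
endpoint : ∀ {k} → Vertex k → List (Fin k) → Vertex k
endpoint u []       = u
endpoint u (i ∷ ds) = endpoint (flipAt u i) ds

changes : ∀ {k} → Coloring k → Vertex k → List (Fin k) → ℕ
changes c u []           = 0
changes c u (i ∷ [])     = 0
changes c u (i ∷ j ∷ ds) =
  (if colour c u i xor colour c (flipAt u i) j then 1 else 0)
  + changes c (flipAt u i) (j ∷ ds)

IsGeodesic : ∀ {k} → Vertex k → Vertex k → List (Fin k) → Set
IsGeodesic u v ds =
  endpoint u ds ≡ v × (∀ ds' → endpoint u ds' ≡ v → length ds ≤ length ds')

IsMinChanges : ∀ {k} → Coloring k → Vertex k → Vertex k → ℕ → Set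
IsMinChanges c u v m =
  (Σ[ ds ∈ List _ ] (IsGeodesic u v ds × changes c u ds ≡ m))
  × (∀ ds → IsGeodesic u v ds → m ≤ changes c u ds)

sumV : ∀ k → (Vertex k → ℕ) → ℕ
sumV zero    f = f []
sumV (suc k) f = sumV k (λ v → f (false ∷ v)) + sumV k (λ v → f (true ∷ v))

module Submission where

-- Colour the edge {v , flipAt v i} by (parity of v) xor vᵢ.  Parity alternates along a walk, so two
-- consecutive edges get different colours exactly when they flip bits of equal value: the colour
-- changes of a walk are the repeats in its list of flipped bits.  From u to ū this list contains
-- zeros u falses and ones u trues, hence at least ∣zeros u − ones u∣ − 1 repeats, and a geodesic
-- flipping the bits in alternating order attains the bound.
-- Summed over Q_k, ∣zeros u − ones u∣ gives twice the excess P(k) = Σ_u (zeros u − ones u)⁺.  The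
-- absorption identity a·C(k+1,a) = (k+1)·C(k,a−1) gives P(k+1) = (k+1)·C(k,⌊k/2⌋), the binomial
-- coefficient counting the balanced and nearly balanced vertices of Q_k, and the Wallis-type
-- recurrence this implies yields 8·(2P(k))² ≥ (5k − 7)·4ᵏ.  So the average number of changes is at
-- least √((5k − 7)/8) − 1 ≈ 0.79 √k, which exceeds 0.7 √k once k ≥ 470.

open import Data.Bool using (Bool; true; false; not; _xor_; if_then_else_)
open import Data.Bool.Properties using (not-involutive; not-distribˡ-xor; not-distribʳ-xor)
open import Data.Empty using (⊥-elim)
open import Data.Fin using (Fin; zero; suc)
open import Data.List using (List; []; _∷_; replicate; length)
open import Data.Nat using (ℕ; zero; suc; _+_; _*_; _∸_; _^_; _≤_; z≤n; s≤s; ∣_-_∣; _≡ᵇ_; _<ᵇ_)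
open import Data.Nat.Properties
open import Algebra.Properties.CommutativeSemigroup +-commutativeSemigroup using (xy∙z≈xz∙y; x∙yz≈y∙xz; interchange)
open import Data.Nat.Tactic.RingSolver using (solve-∀)
open import Data.Product using (Σ; Σ-syntax; _×_; _,_; proj₁)
open import Data.Sum using (_⊎_; inj₁; inj₂; [_,_]′)
open import Data.Vec using (_∷_; []; lookup; toList)
open import Data.Vec.Properties using (lookup∘updateAt)
open import Function using (_∘_)
open import Relation.Binary.PropositionalEquality

open import Defs

-- Repeats in lists of bits

δ : Bool → Bool → ℕ
δ true  true  = 1
δ false false = 1
δ true  false = 0
δ false true  = 0

δ-refl : ∀ b → δ b b ≡ 1
δ-refl true  = refl
δ-refl false = refl

δ-not : ∀ b → δ b (not b) ≡ 0
δ-not true  = refl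
δ-not false = refl

δ-notˡ : ∀ b → δ (not b) b ≡ 0
δ-notˡ true  = refl
δ-notˡ false = refl

δ-≤-1 : ∀ b c → δ b c ≤ 1
δ-≤-1 true  true  = ≤-refl
δ-≤-1 false false = ≤-refl
δ-≤-1 true  false = z≤n
δ-≤-1 false true  = z≤n

count : Bool → List Bool → ℕ
count b []      = 0
count b (c ∷ L) = δ b c + count b L

repeatsAfter : Bool → List Bool → ℕ
repeatsAfter p []      = 0
repeatsAfter p (c ∷ L) = δ p c + repeatsAfter c L

repeats : List Bool → ℕ
repeats []      = 0
repeats (c ∷ L) = repeatsAfter c L

length-count : ∀ L → length L ≡ count false L + count true L
length-count []          = refl
length-count (true  ∷ L) = trans (cong suc (length-count L)) (sym (+-suc _ _))
length-count (false ∷ L) = cong suc (length-count L)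

repeatsAfter-≤-suc : ∀ p q L → repeatsAfter p L ≤ suc (repeatsAfter q L)
repeatsAfter-≤-suc p q []      = z≤n
repeatsAfter-≤-suc p q (c ∷ L) =
  ≤-trans (+-monoˡ-≤ (repeatsAfter c L) (δ-≤-1 p c)) (s≤s (m≤n+m (repeatsAfter c L) (δ q c)))

repeatsAfter-+-≤ : ∀ p q L n → repeatsAfter p L + n ≤ repeatsAfter q L + suc n
repeatsAfter-+-≤ p q L n =
  ≤-trans (+-monoˡ-≤ n (repeatsAfter-≤-suc p q L)) (≤-reflexive (sym (+-suc _ n)))

count-≤-repeatsAfter : ∀ p L → count p L ≤ repeatsAfter p L + count (not p) L
count-≤-repeatsAfter p [] = z≤n
count-≤-repeatsAfter true  (true ∷ L)  = s≤s (count-≤-repeatsAfter true L)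
count-≤-repeatsAfter false (false ∷ L) = s≤s (count-≤-repeatsAfter false L)
count-≤-repeatsAfter true  (false ∷ L) =
  ≤-trans (count-≤-repeatsAfter true L) (repeatsAfter-+-≤ true false L (count false L))
count-≤-repeatsAfter false (true ∷ L)  =
  ≤-trans (count-≤-repeatsAfter false L) (repeatsAfter-+-≤ false true L (count true L))

count-≤-repeats : ∀ p P → count p P ≤ suc (repeats P + count (not p) P)
count-≤-repeats p []      = z≤n
count-≤-repeats p (c ∷ L) =
  ≤-trans (count-≤-repeatsAfter p (c ∷ L)) (+-monoˡ-≤ _ (+-monoˡ-≤ _ (δ-≤-1 p c)))

∣m-n∣∸1≤ : ∀ {m n r} → m ≤ suc r + n → n ≤ suc r + m → ∣ m - n ∣ ∸ 1 ≤ r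
∣m-n∣∸1≤ {m} {n} {r} m≤ n≤ with ∣m-n∣≡[m∸n]∨[n∸m] m n
... | inj₁ eq rewrite eq = ∸-monoˡ-≤ 1 (m≤n+o⇒m∸n≤o m n (subst (m ≤_) (+-comm (suc r) n) m≤))
... | inj₂ eq rewrite eq = ∸-monoˡ-≤ 1 (m≤n+o⇒m∸n≤o n m (subst (n ≤_) (+-comm (suc r) m) n≤))

∣count-count∣∸1≤repeats : ∀ P → ∣ count false P - count true P ∣ ∸ 1 ≤ repeats P
∣count-count∣∸1≤repeats P = ∣m-n∣∸1≤ (count-≤-repeats false P) (count-≤-repeats true P)

zigzag : Bool → ℕ → ℕ → List Bool
zigzag x zero    e = replicate e x
zigzag x (suc m) e = x ∷ not x ∷ zigzag x m e

count-zigzag : ∀ x m e → count x (zigzag x m e) ≡ m + e × count (not x) (zigzag x m e) ≡ m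
count-zigzag x zero zero = refl , refl
count-zigzag x zero (suc e) with count-zigzag x zero e
... | c₁ , c₂ rewrite δ-refl x | δ-notˡ x = cong suc c₁ , c₂
count-zigzag x (suc m) e with count-zigzag x m e
... | c₁ , c₂ rewrite δ-refl x | δ-not x | δ-notˡ x | δ-refl (not x) = cong suc c₁ , cong suc c₂

repeatsAfter-replicate : ∀ x e → repeatsAfter x (replicate e x) ≡ e
repeatsAfter-replicate x zero    = refl
repeatsAfter-replicate x (suc e) rewrite δ-refl x = cong suc (repeatsAfter-replicate x e)

repeatsAfter-not-zigzag : ∀ x m e → repeatsAfter (not x) (zigzag x m e) ≡ e ∸ 1
repeatsAfter-not-zigzag x zero    zero    = refl
repeatsAfter-not-zigzag x zero    (suc e) rewrite δ-notˡ x = repeatsAfter-replicate x e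
repeatsAfter-not-zigzag x (suc m) e rewrite δ-notˡ x | δ-not x = repeatsAfter-not-zigzag x m e

repeats-zigzag : ∀ x m e → repeats (zigzag x m e) ≡ e ∸ 1
repeats-zigzag x zero    zero    = refl
repeats-zigzag x zero    (suc e) = repeatsAfter-replicate x e
repeats-zigzag x (suc m) e rewrite δ-not x = repeatsAfter-not-zigzag x m e

optimalPattern : ∀ a b → Σ[ P ∈ List Bool ]
  (count false P ≡ a × count true P ≡ b × repeats P ≡ ∣ a - b ∣ ∸ 1)
optimalPattern a b with ≤-total b a
... | inj₁ b≤a with count-zigzag false b (a ∸ b)
...   | c₁ , c₂ = zigzag false b (a ∸ b) , trans c₁ (m+[n∸m]≡n b≤a) , c₂ ,
        trans (repeats-zigzag false b (a ∸ b)) (cong (_∸ 1) (sym (trans (∣-∣-comm a b) (m≤n⇒∣m-n∣≡n∸m b≤a))))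
optimalPattern a b | inj₂ a≤b with count-zigzag true a (b ∸ a)
...   | c₁ , c₂ = zigzag true a (b ∸ a) , c₂ , trans c₁ (m+[n∸m]≡n a≤b) ,
        trans (repeats-zigzag true a (b ∸ a)) (cong (_∸ 1) (sym (m≤n⇒∣m-n∣≡n∸m a≤b)))

-- The parity colouring and walks in the hypercube

zeros ones : ∀ {k} → Vertex k → ℕ
zeros u = count false (toList u)
ones  u = count true  (toList u)

minChanges : ∀ {k} → Vertex k → ℕ
minChanges u = ∣ zeros u - ones u ∣ ∸ 1

parity : ∀ {k} → Vertex k → Bool
parity []      = false
parity (b ∷ v) = b xor parity v

parity-flipAt : ∀ {k} (v : Vertex k) i → parity (flipAt v i) ≡ not (parity v)
parity-flipAt (b ∷ v) zero    = sym (not-distribˡ-xor b (parity v))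
parity-flipAt (b ∷ v) (suc i) = trans (cong (b xor_) (parity-flipAt v i)) (sym (not-distribʳ-xor b (parity v)))

not-xor-not : ∀ x y → not x xor not y ≡ x xor y
not-xor-not x y = begin
  not x xor not y     ≡⟨ not-distribˡ-xor x (not y) ⟨
  not (x xor not y)   ≡⟨ cong not (not-distribʳ-xor x y) ⟨
  not (not (x xor y)) ≡⟨ not-involutive (x xor y) ⟩
  x xor y             ∎
  where open ≡-Reasoning

parityColouring : ∀ k → Coloring k
parityColouring k = (λ v i → parity v xor lookup v i) , invariant
  where
  invariant : ∀ (v : Vertex k) i → parity (flipAt v i) xor lookup (flipAt v i) i ≡ parity v xor lookup v i
  invariant v i rewrite parity-flipAt v i | lookup∘updateAt i {not} v = not-xor-not (parity v) (lookup v i)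

directions : ∀ {k} → Vertex k → List (Fin k) → List Bool
directions w []       = []
directions w (i ∷ ds) = lookup w i ∷ directions (flipAt w i) ds

length-directions : ∀ {k} (w : Vertex k) ds → length (directions w ds) ≡ length ds
length-directions w []       = refl
length-directions w (i ∷ ds) = cong suc (length-directions (flipAt w i) ds)

colour-change-δ : ∀ p a b → (if (p xor a) xor (not p xor b) then 1 else 0) ≡ δ a b
colour-change-δ true  true  true  = refl
colour-change-δ true  true  false = refl
colour-change-δ true  false true  = refl
colour-change-δ true  false false = refl
colour-change-δ false true  true  = refl
colour-change-δ false true  false = refl
colour-change-δ false false true  = refl
colour-change-δ false false false = refl

changes-parityColouring : ∀ {k} (u : Vertex k) ds →
  changes (parityColouring k) u ds ≡ repeats (directions u ds)
changes-parityColouring u []           = refl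
changes-parityColouring u (i ∷ [])     = refl
changes-parityColouring u (i ∷ j ∷ ds) = cong₂ _+_ change (changes-parityColouring (flipAt u i) (j ∷ ds))
  where
  w = flipAt u i
  change : (if (parity u xor lookup u i) xor (parity w xor lookup w j) then 1 else 0) ≡ δ (lookup u i) (lookup w j)
  change rewrite parity-flipAt u i = colour-change-δ (parity u) (lookup u i) (lookup w j)

ones-flipAt : ∀ {k} (w : Vertex k) i →
  ones w + δ false (lookup w i) ≡ ones (flipAt w i) + δ true (lookup w i)
ones-flipAt (true  ∷ w) zero    = trans (+-identityʳ _) (+-comm 1 (ones w))
ones-flipAt (false ∷ w) zero    = sym (trans (+-identityʳ _) (+-comm 1 (ones w)))
ones-flipAt (b ∷ w) (suc i) =
  trans (+-assoc (δ true b) _ _) (trans (cong (δ true b +_) (ones-flipAt w i)) (sym (+-assoc (δ true b) _ _)))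

walk-balance : ∀ {k} (w : Vertex k) ds →
  ones w + count false (directions w ds) ≡ ones (endpoint w ds) + count true (directions w ds)
walk-balance w [] = refl
walk-balance w (i ∷ ds) = begin
  ones w + (δ false c + #f)  ≡⟨ +-assoc (ones w) _ _ ⟨
  ones w + δ false c + #f    ≡⟨ cong (_+ #f) (ones-flipAt w i) ⟩
  ones w′ + δ true c + #f    ≡⟨ xy∙z≈xz∙y (ones w′) (δ true c) #f ⟩
  ones w′ + #f + δ true c    ≡⟨ cong (_+ δ true c) (walk-balance w′ ds) ⟩
  ones e + #t + δ true c     ≡⟨ xy∙z≈xz∙y (ones e) #t (δ true c) ⟩
  ones e + δ true c + #t     ≡⟨ +-assoc (ones e) _ _ ⟩
  ones e + (δ true c + #t)   ∎
  where
  open ≡-Reasoning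
  c = lookup w i
  w′ = flipAt w i
  e = endpoint w′ ds
  #f = count false (directions w′ ds)
  #t = count true (directions w′ ds)

ones-complement : ∀ {k} (u : Vertex k) → ones (complement u) ≡ zeros u
ones-complement []          = refl
ones-complement (true  ∷ u) = ones-complement u
ones-complement (false ∷ u) = cong suc (ones-complement u)

∣-∣-transfer : ∀ {a b m n} → a + m ≡ b + n → ∣ b - a ∣ ≡ ∣ m - n ∣
∣-∣-transfer {a} {b} {m} {n} eq = begin
  ∣ b - a ∣          ≡⟨ ∣m+n-m+o∣≡∣n-o∣ n b a ⟨
  ∣ n + b - n + a ∣  ≡⟨ cong₂ ∣_-_∣ (trans (+-comm n b) (sym eq)) (+-comm n a) ⟩
  ∣ a + m - a + n ∣  ≡⟨ ∣m+n-m+o∣≡∣n-o∣ a m n ⟩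
  ∣ m - n ∣          ∎
  where open ≡-Reasoning

minChanges-≤-changes : ∀ {k} (u : Vertex k) ds → endpoint u ds ≡ complement u →
  minChanges u ≤ changes (parityColouring k) u ds
minChanges-≤-changes {k} u ds end = begin
  ∣ zeros u - ones u ∣ ∸ 1              ≡⟨ cong (_∸ 1) (∣-∣-transfer {ones u} {zeros u} balance) ⟩
  ∣ count false D - count true D ∣ ∸ 1  ≤⟨ ∣count-count∣∸1≤repeats D ⟩
  repeats D                             ≡⟨ changes-parityColouring u ds ⟨
  changes (parityColouring k) u ds      ∎
  where
  open ≤-Reasoning
  D = directions u ds
  balance : ones u + count false D ≡ zeros u + count true D
  balance = trans (walk-balance u ds) (cong (_+ count true D) (trans (cong ones end) (ones-complement u)))

differences : ∀ {k} → Vertex k → Vertex k → List Bool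
differences []          []          = []
differences (true  ∷ u) (false ∷ v) = true  ∷ differences u v
differences (false ∷ u) (true  ∷ v) = false ∷ differences u v
differences (true  ∷ u) (true  ∷ v) = differences u v
differences (false ∷ u) (false ∷ v) = differences u v

differences-self : ∀ {k} (u : Vertex k) → differences u u ≡ []
differences-self []          = refl
differences-self (true  ∷ u) = differences-self u
differences-self (false ∷ u) = differences-self u

differences-complement : ∀ {k} (u : Vertex k) → differences u (complement u) ≡ toList u
differences-complement []          = refl
differences-complement (true  ∷ u) = cong (true ∷_) (differences-complement u)
differences-complement (false ∷ u) = cong (false ∷_) (differences-complement u)

no-differences : ∀ {k} (u v : Vertex k) → (∀ c → count c (differences u v) ≡ 0) → u ≡ v
no-differences []          []          h = refl
no-differences (true  ∷ u) (false ∷ v) h with () ← h true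
no-differences (false ∷ u) (true  ∷ v) h with () ← h false
no-differences (true  ∷ u) (true  ∷ v) h = cong (true ∷_) (no-differences u v h)
no-differences (false ∷ u) (false ∷ v) h = cong (false ∷_) (no-differences u v h)

length-differences-flipAt : ∀ {k} (u v : Vertex k) i →
  length (differences u v) ≤ suc (length (differences (flipAt u i) v))
length-differences-flipAt (true  ∷ u) (false ∷ v) zero    = ≤-refl
length-differences-flipAt (false ∷ u) (true  ∷ v) zero    = ≤-refl
length-differences-flipAt (true  ∷ u) (true  ∷ v) zero    = m≤n+m _ 2
length-differences-flipAt (false ∷ u) (false ∷ v) zero    = m≤n+m _ 2
length-differences-flipAt (true  ∷ u) (false ∷ v) (suc i) = s≤s (length-differences-flipAt u v i)
length-differences-flipAt (false ∷ u) (true  ∷ v) (suc i) = s≤s (length-differences-flipAt u v i)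
length-differences-flipAt (true  ∷ u) (true  ∷ v) (suc i) = length-differences-flipAt u v i
length-differences-flipAt (false ∷ u) (false ∷ v) (suc i) = length-differences-flipAt u v i

length-differences-≤ : ∀ {k} (u v : Vertex k) ds → endpoint u ds ≡ v → length (differences u v) ≤ length ds
length-differences-≤ u v []       refl = ≤-reflexive (cong length (differences-self u))
length-differences-≤ u v (i ∷ ds) end  =
  ≤-trans (length-differences-flipAt u v i) (s≤s (length-differences-≤ (flipAt u i) v ds end))

remove-difference : ∀ {k} (u v : Vertex k) p {n} → count p (differences u v) ≡ suc n →
  Σ[ i ∈ Fin k ] (lookup u i ≡ p ×
    (∀ c → count c (differences u v) ≡ δ c p + count c (differences (flipAt u i) v)))
remove-difference [] [] p ()
remove-difference (true  ∷ u) (false ∷ v) true  _ = zero , refl , λ c → refl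
remove-difference (false ∷ u) (true  ∷ v) false _ = zero , refl , λ c → refl
remove-difference (true  ∷ u) (false ∷ v) false h with remove-difference u v false h
... | i , u[i] , counts = suc i , u[i] , λ c →
  trans (cong (δ c true +_) (counts c)) (x∙yz≈y∙xz (δ c true) (δ c false) _)
remove-difference (false ∷ u) (true  ∷ v) true  h with remove-difference u v true h
... | i , u[i] , counts = suc i , u[i] , λ c →
  trans (cong (δ c false +_) (counts c)) (x∙yz≈y∙xz (δ c false) (δ c true) _)
remove-difference (true  ∷ u) (true  ∷ v) p h with remove-difference u v p h
... | i , u[i] , counts = suc i , u[i] , counts
remove-difference (false ∷ u) (false ∷ v) p h with remove-difference u v p h
... | i , u[i] , counts = suc i , u[i] , counts

realise : ∀ {k} (u v : Vertex k) P → (∀ c → count c P ≡ count c (differences u v)) →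
  Σ[ ds ∈ List (Fin k) ] (endpoint u ds ≡ v × directions u ds ≡ P)
realise u v [] h = [] , no-differences u v (λ c → sym (h c)) , refl
realise u v (p ∷ P) h with remove-difference u v p (trans (sym (h p)) (cong (_+ count p P) (δ-refl p)))
... | i , u[i] , removal with realise (flipAt u i) v P counts
  where
  counts : ∀ c → count c P ≡ count c (differences (flipAt u i) v)
  counts c = +-cancelˡ-≡ (δ c p) _ _ (trans (h c) (removal c))
... | ds , end , dirs = i ∷ ds , end , cong₂ _∷_ u[i] dirs

realise-geodesic : ∀ {k} (u v : Vertex k) P → (∀ c → count c P ≡ count c (differences u v)) →
  Σ[ ds ∈ List (Fin k) ] (IsGeodesic u v ds × directions u ds ≡ P)
realise-geodesic u v P h with realise u v P h
... | ds , end , dirs = ds , (end , shortest) , dirs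
  where
  length-ds : length ds ≡ length (differences u v)
  length-ds = begin
    length ds                                                     ≡⟨ length-directions u ds ⟨
    length (directions u ds)                                      ≡⟨ cong length dirs ⟩
    length P                                                      ≡⟨ length-count P ⟩
    count false P + count true P                                  ≡⟨ cong₂ _+_ (h false) (h true) ⟩
    count false (differences u v) + count true (differences u v)  ≡⟨ length-count (differences u v) ⟨
    length (differences u v)                                      ∎
    where open ≡-Reasoning
  shortest : ∀ ds′ → endpoint u ds′ ≡ v → length ds ≤ length ds′
  shortest ds′ end′ = subst (_≤ length ds′) (sym length-ds) (length-differences-≤ u v ds′ end′)

minChanges-parityColouring : ∀ {k} (u : Vertex k) →
  IsMinChanges (parityColouring k) u (complement u) (minChanges u)
minChanges-parityColouring {k} u with optimalPattern (zeros u) (ones u)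
... | P , #false , #true , repeats-P with realise-geodesic u (complement u) P counts
  where
  counts : ∀ c → count c P ≡ count c (differences u (complement u))
  counts c rewrite differences-complement u with c
  ... | false = #false
  ... | true  = #true
... | ds , geodesic , dirs =
  (ds , geodesic , trans (changes-parityColouring u ds) (trans (cong repeats dirs) repeats-P)) ,
  λ ds′ geodesic′ → minChanges-≤-changes u ds′ (proj₁ geodesic′)

-- Sums over the hypercube by numbers of zeros and ones

sumCounts : ∀ k → (ℕ → ℕ → ℕ) → ℕ
sumCounts k g = sumV k (λ v → g (zeros v) (ones v))

sumCounts-cong : ∀ k {g h : ℕ → ℕ → ℕ} → (∀ a b → a + b ≡ k → g a b ≡ h a b) →
  sumCounts k g ≡ sumCounts k h
sumCounts-cong zero    g≡h = g≡h 0 0 refl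
sumCounts-cong (suc k) g≡h = cong₂ _+_
  (sumCounts-cong k (λ a b a+b≡k → g≡h (suc a) b (cong suc a+b≡k)))
  (sumCounts-cong k (λ a b a+b≡k → g≡h a (suc b) (trans (+-suc a b) (cong suc a+b≡k))))

sumCounts-mono : ∀ k {g h : ℕ → ℕ → ℕ} → (∀ a b → g a b ≤ h a b) → sumCounts k g ≤ sumCounts k h
sumCounts-mono zero    g≤h = g≤h 0 0
sumCounts-mono (suc k) g≤h = +-mono-≤
  (sumCounts-mono k (λ a b → g≤h (suc a) b)) (sumCounts-mono k (λ a b → g≤h a (suc b)))

sumCounts-+ : ∀ k (g h : ℕ → ℕ → ℕ) →
  sumCounts k (λ a b → g a b + h a b) ≡ sumCounts k g + sumCounts k h
sumCounts-+ zero    g h = refl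
sumCounts-+ (suc k) g h = trans
  (cong₂ _+_ (sumCounts-+ k (λ a b → g (suc a) b) (λ a b → h (suc a) b))
             (sumCounts-+ k (λ a b → g a (suc b)) (λ a b → h a (suc b))))
  (interchange (sumCounts k (λ a b → g (suc a) b)) (sumCounts k (λ a b → h (suc a) b))
               (sumCounts k (λ a b → g a (suc b))) (sumCounts k (λ a b → h a (suc b))))

sumCounts-const : ∀ k c → sumCounts k (λ _ _ → c) ≡ 2 ^ k * c
sumCounts-const zero    c = sym (+-identityʳ c)
sumCounts-const (suc k) c =
  trans (cong₂ _+_ (sumCounts-const k c) (sumCounts-const k c)) (double (2 ^ k) c)
  where
  double : ∀ p c → p * c + p * c ≡ 2 * p * c
  double = solve-∀

sumCounts-swap : ∀ k (g : ℕ → ℕ → ℕ) → sumCounts k g ≡ sumCounts k (λ a b → g b a)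
sumCounts-swap zero    g = refl
sumCounts-swap (suc k) g = trans
  (cong₂ _+_ (sumCounts-swap k (λ a b → g (suc a) b)) (sumCounts-swap k (λ a b → g a (suc b))))
  (+-comm (sumCounts k (λ a b → g (suc b) a)) (sumCounts k (λ a b → g b (suc a))))

sumCounts-absorb : ∀ k (G : ℕ → ℕ → ℕ) →
  sumCounts (suc k) (λ a b → a * G a b) ≡ suc k * sumCounts k (λ a b → G (suc a) b)
sumCounts-absorb zero    G = +-identityʳ _
sumCounts-absorb (suc k) G = begin
  sumCounts (suc k) (λ a b → suc a * G (suc a) b) + R
    ≡⟨ cong (_+ R) (sumCounts-+ (suc k) (λ a b → G (suc a) b) (λ a b → a * G (suc a) b)) ⟩
  S + sumCounts (suc k) (λ a b → a * G (suc a) b) + R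
    ≡⟨ cong₂ (λ x y → S + x + y) (sumCounts-absorb k (λ a b → G (suc a) b))
                                 (sumCounts-absorb k (λ a b → G a (suc b))) ⟩
  S + suc k * A + suc k * B    ≡⟨ +-assoc S (suc k * A) (suc k * B) ⟩
  S + (suc k * A + suc k * B)  ≡⟨ cong (S +_) (*-distribˡ-+ (suc k) A B) ⟨
  S + suc k * S                ∎
  where
  open ≡-Reasoning
  R = sumCounts (suc k) (λ a b → a * G a (suc b))
  A = sumCounts k (λ a b → G (suc (suc a)) b)
  B = sumCounts k (λ a b → G (suc a) (suc b))
  S = sumCounts (suc k) (λ a b → G (suc a) b)

sumCounts-absorbʳ : ∀ k (G : ℕ → ℕ → ℕ) →
  sumCounts (suc k) (λ a b → b * G a b) ≡ suc k * sumCounts k (λ a b → G a (suc b))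
sumCounts-absorbʳ k G = begin
  sumCounts (suc k) (λ a b → b * G a b)      ≡⟨ sumCounts-swap (suc k) (λ a b → b * G a b) ⟩
  sumCounts (suc k) (λ a b → a * G b a)      ≡⟨ sumCounts-absorb k (λ a b → G b a) ⟩
  suc k * sumCounts k (λ a b → G b (suc a))  ≡⟨ cong (suc k *_) (sumCounts-swap k (λ a b → G b (suc a))) ⟩
  suc k * sumCounts k (λ a b → G a (suc b))  ∎
  where open ≡-Reasoning


𝟙 : Bool → ℕ
𝟙 true  = 1
𝟙 false = 0

excess balanced nearlyBalanced : ℕ → ℕ
excess         k = sumCounts k (λ a b → a ∸ b)
balanced       k = sumCounts k (λ a b → 𝟙 (a ≡ᵇ b))
nearlyBalanced k = sumCounts k (λ a b → 𝟙 (a ≡ᵇ suc b))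

m*𝟙[n<m]≡m∸n+n*𝟙[n<m] : ∀ m n → m * 𝟙 (n <ᵇ m) ≡ (m ∸ n) + n * 𝟙 (n <ᵇ m)
m*𝟙[n<m]≡m∸n+n*𝟙[n<m] zero    zero    = refl
m*𝟙[n<m]≡m∸n+n*𝟙[n<m] zero    (suc n) = sym (*-zeroʳ (suc n))
m*𝟙[n<m]≡m∸n+n*𝟙[n<m] (suc m) zero    = trans (*-identityʳ (suc m)) (sym (+-identityʳ (suc m)))
m*𝟙[n<m]≡m∸n+n*𝟙[n<m] (suc m) (suc n) =
  trans (cong (x +_) (m*𝟙[n<m]≡m∸n+n*𝟙[n<m] m n)) (x∙yz≈y∙xz x (m ∸ n) (n * x))
  where x = 𝟙 (n <ᵇ m)

𝟙[n<1+m]-split : ∀ m n → 𝟙 (n <ᵇ suc m) ≡ 𝟙 (suc n <ᵇ m) + (𝟙 (m ≡ᵇ n) + 𝟙 (m ≡ᵇ suc n))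
𝟙[n<1+m]-split zero          zero    = refl
𝟙[n<1+m]-split zero          (suc n) = refl
𝟙[n<1+m]-split (suc zero)    zero    = refl
𝟙[n<1+m]-split (suc (suc m)) zero    = refl
𝟙[n<1+m]-split (suc m)       (suc n) = 𝟙[n<1+m]-split m n

excess-suc : ∀ k → excess (suc k) ≡ suc k * (balanced k + nearlyBalanced k)
excess-suc k = +-cancelʳ-≡ (suc k * L) (excess (suc k)) (suc k * C) (begin
  excess (suc k) + suc k * L
    ≡⟨ cong (excess (suc k) +_) (sumCounts-absorbʳ k (λ a b → 𝟙 (b <ᵇ a))) ⟨
  excess (suc k) + sumCounts (suc k) (λ a b → b * 𝟙 (b <ᵇ a))
    ≡⟨ sumCounts-+ (suc k) (λ a b → a ∸ b) (λ a b → b * 𝟙 (b <ᵇ a)) ⟨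
  sumCounts (suc k) (λ a b → (a ∸ b) + b * 𝟙 (b <ᵇ a))
    ≡⟨ sumCounts-cong (suc k) (λ a b _ → m*𝟙[n<m]≡m∸n+n*𝟙[n<m] a b) ⟨
  sumCounts (suc k) (λ a b → a * 𝟙 (b <ᵇ a))
    ≡⟨ sumCounts-absorb k (λ a b → 𝟙 (b <ᵇ a)) ⟩
  suc k * sumCounts k (λ a b → 𝟙 (b <ᵇ suc a))
    ≡⟨ cong (suc k *_) split ⟩
  suc k * (L + C)
    ≡⟨ *-distribˡ-+ (suc k) L C ⟩
  suc k * L + suc k * C
    ≡⟨ +-comm (suc k * L) (suc k * C) ⟩
  suc k * C + suc k * L
    ∎)
  where
  open ≡-Reasoning
  L = sumCounts k (λ a b → 𝟙 (suc b <ᵇ a))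
  C = balanced k + nearlyBalanced k
  split : sumCounts k (λ a b → 𝟙 (b <ᵇ suc a)) ≡ L + C
  split = begin
    sumCounts k (λ a b → 𝟙 (b <ᵇ suc a))
      ≡⟨ sumCounts-cong k (λ a b _ → 𝟙[n<1+m]-split a b) ⟩
    sumCounts k (λ a b → 𝟙 (suc b <ᵇ a) + (𝟙 (a ≡ᵇ b) + 𝟙 (a ≡ᵇ suc b)))
      ≡⟨ sumCounts-+ k (λ a b → 𝟙 (suc b <ᵇ a)) (λ a b → 𝟙 (a ≡ᵇ b) + 𝟙 (a ≡ᵇ suc b)) ⟩
    L + sumCounts k (λ a b → 𝟙 (a ≡ᵇ b) + 𝟙 (a ≡ᵇ suc b))
      ≡⟨ cong (L +_) (sumCounts-+ k (λ a b → 𝟙 (a ≡ᵇ b)) (λ a b → 𝟙 (a ≡ᵇ suc b))) ⟩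
    L + C
      ∎

≡ᵇ-sym : ∀ m n → (m ≡ᵇ n) ≡ (n ≡ᵇ m)
≡ᵇ-sym zero    zero    = refl
≡ᵇ-sym zero    (suc n) = refl
≡ᵇ-sym (suc m) zero    = refl
≡ᵇ-sym (suc m) (suc n) = ≡ᵇ-sym m n

𝟙-≡ᵇ-≢ : ∀ {m n} → m ≢ n → 𝟙 (m ≡ᵇ n) ≡ 0
𝟙-≡ᵇ-≢ {zero}  {zero}  m≢n = ⊥-elim (m≢n refl)
𝟙-≡ᵇ-≢ {zero}  {suc n} _   = refl
𝟙-≡ᵇ-≢ {suc m} {zero}  _   = refl
𝟙-≡ᵇ-≢ {suc m} {suc n} m≢n = 𝟙-≡ᵇ-≢ (m≢n ∘ cong suc)

balanced-suc : ∀ k → balanced (suc k) ≡ 2 * nearlyBalanced k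
balanced-suc k = begin
  sumCounts k (λ a b → 𝟙 (suc a ≡ᵇ b)) + N
    ≡⟨ cong (_+ N) (sumCounts-swap k (λ a b → 𝟙 (suc a ≡ᵇ b))) ⟩
  sumCounts k (λ a b → 𝟙 (suc b ≡ᵇ a)) + N
    ≡⟨ cong (_+ N) (sumCounts-cong k (λ a b _ → cong 𝟙 (≡ᵇ-sym (suc b) a))) ⟩
  N + N
    ≡⟨ cong (N +_) (+-identityʳ N) ⟨
  2 * N
    ∎
  where
  open ≡-Reasoning
  N = nearlyBalanced k

balanced-odd : ∀ n → balanced (suc (n + n)) ≡ 0
balanced-odd n = begin
  balanced (suc (n + n))                  ≡⟨ sumCounts-cong (suc (n + n)) (λ a b a+b≡odd → 𝟙-≡ᵇ-≢ (a≢b a b a+b≡odd)) ⟩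
  sumCounts (suc (n + n)) (λ _ _ → 0)     ≡⟨ sumCounts-const (suc (n + n)) 0 ⟩
  2 ^ suc (n + n) * 0                     ≡⟨ *-zeroʳ (2 ^ suc (n + n)) ⟩
  0                                       ∎
  where
  open ≡-Reasoning
  a≢b : ∀ a b → a + b ≡ suc (n + n) → a ≢ b
  a≢b a .a a+a≡odd refl = even≢odd a n (begin
    2 * a        ≡⟨ cong (a +_) (+-identityʳ a) ⟩
    a + a        ≡⟨ a+a≡odd ⟩
    suc (n + n)  ≡⟨ cong (λ m → suc (n + m)) (+-identityʳ n) ⟨
    suc (2 * n)  ∎)

[1+n]+[1+n]≡2+[n+n] : ∀ n → suc n + suc n ≡ suc (suc (n + n))
[1+n]+[1+n]≡2+[n+n] n = cong suc (+-suc n n)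

excess-even : ∀ n → excess (n + n) ≡ n * balanced (n + n)
excess-even zero    = refl
excess-even (suc m) = begin
  excess (suc m + suc m)                             ≡⟨ cong excess ([1+n]+[1+n]≡2+[n+n] m) ⟩
  excess (suc (suc (m + m)))                         ≡⟨ excess-suc (suc (m + m)) ⟩
  suc (suc (m + m)) * (balanced (suc (m + m)) + N)   ≡⟨ cong (λ z → suc (suc (m + m)) * (z + N)) (balanced-odd m) ⟩
  suc (suc (m + m)) * N                              ≡⟨ regroup m N ⟩
  suc m * (2 * N)                                    ≡⟨ cong (suc m *_) (balanced-suc (suc (m + m))) ⟨
  suc m * balanced (suc (suc (m + m)))               ≡⟨ cong (λ j → suc m * balanced j) ([1+n]+[1+n]≡2+[n+n] m) ⟨
  suc m * balanced (suc m + suc m)                   ∎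
  where
  open ≡-Reasoning
  N = nearlyBalanced (suc (m + m))
  regroup : ∀ m N → suc (suc (m + m)) * N ≡ suc m * (2 * N)
  regroup = solve-∀

balanced-≤-excess : ∀ k → suc k * balanced k ≤ excess (suc k)
balanced-≤-excess k = subst (suc k * balanced k ≤_) (sym (excess-suc k))
  (*-monoʳ-≤ (suc k) (m≤m+n (balanced k) (nearlyBalanced k)))

[m∸n]+[m∸n]≤[1+m∸n]+[m∸1+n] : ∀ m n → (m ∸ n) + (m ∸ n) ≤ (suc m ∸ n) + (m ∸ suc n)
[m∸n]+[m∸n]≤[1+m∸n]+[m∸1+n] zero    zero    = z≤n
[m∸n]+[m∸n]≤[1+m∸n]+[m∸1+n] (suc m) zero    = s≤s (≤-reflexive (+-suc m m))
[m∸n]+[m∸n]≤[1+m∸n]+[m∸1+n] zero    (suc n) = z≤n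
[m∸n]+[m∸n]≤[1+m∸n]+[m∸1+n] (suc m) (suc n) = [m∸n]+[m∸n]≤[1+m∸n]+[m∸1+n] m n

excess-double-≤ : ∀ k → 2 * excess k ≤ excess (suc k)
excess-double-≤ k = begin
  2 * excess k                                     ≡⟨ cong (excess k +_) (+-identityʳ (excess k)) ⟩
  excess k + excess k                              ≡⟨ sumCounts-+ k (λ a b → a ∸ b) (λ a b → a ∸ b) ⟨
  sumCounts k (λ a b → (a ∸ b) + (a ∸ b))          ≤⟨ sumCounts-mono k [m∸n]+[m∸n]≤[1+m∸n]+[m∸1+n] ⟩
  sumCounts k (λ a b → (suc a ∸ b) + (a ∸ suc b))  ≡⟨ sumCounts-+ k (λ a b → suc a ∸ b) (λ a b → a ∸ suc b) ⟩
  excess (suc k)                                   ∎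
  where open ≤-Reasoning

excess-recurrence : ∀ n → 2 * suc (n + n) * excess (n + n) ≤ n * excess (suc n + suc n)
excess-recurrence n = begin
  2 * suc (n + n) * excess (n + n)            ≡⟨ cong (2 * suc (n + n) *_) (excess-even n) ⟩
  2 * suc (n + n) * (n * balanced (n + n))    ≡⟨ regroup (suc (n + n)) n (balanced (n + n)) ⟩
  n * (2 * (suc (n + n) * balanced (n + n)))  ≤⟨ *-monoʳ-≤ n (*-monoʳ-≤ 2 (balanced-≤-excess (n + n))) ⟩
  n * (2 * excess (suc (n + n)))              ≤⟨ *-monoʳ-≤ n (excess-double-≤ (suc (n + n))) ⟩
  n * excess (suc (suc (n + n)))              ≡⟨ cong (λ j → n * excess j) ([1+n]+[1+n]≡2+[n+n] n) ⟨
  n * excess (suc n + suc n)                  ∎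
  where
  open ≤-Reasoning
  regroup : ∀ s n z → 2 * s * (n * z) ≡ n * (2 * (s * z))
  regroup = solve-∀

-- Wallis-type growth

4^[[1+n]+[1+n]]≡16*4^[n+n] : ∀ n → 4 ^ (suc n + suc n) ≡ 16 * 4 ^ (n + n)
4^[[1+n]+[1+n]]≡16*4^[n+n] n =
  trans (cong (4 ^_) ([1+n]+[1+n]≡2+[n+n] n)) (sym (*-assoc 4 4 (4 ^ (n + n))))

wallis-step : ∀ m → let n = suc m in
  5 * n * 4 ^ (n + n) ≤ 16 * (excess (n + n) * excess (n + n)) + 4 ^ (n + n) →
  5 * suc n * 4 ^ (suc n + suc n) ≤ 16 * (excess (suc n + suc n) * excess (suc n + suc n)) + 4 ^ (suc n + suc n)
wallis-step m ih = subst (λ p → 5 * suc n * p ≤ 16 * (Y * Y) + p) (sym (4^[[1+n]+[1+n]]≡16*4^[n+n] n))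
  (*-cancelˡ-≤ (n * n) (+-cancelʳ-≤ (4 * (s * s) * q) _ _ (begin
  n * n * (5 * suc n * (16 * q)) + 4 * (s * s) * q
    ≤⟨ m≤m+n _ (4 * m * q) ⟩
  n * n * (5 * suc n * (16 * q)) + 4 * (s * s) * q + 4 * m * q
    ≡⟨ poly m q ⟩
  4 * (s * s) * (5 * n * q) + 16 * (n * n) * q
    ≤⟨ +-monoˡ-≤ _ (*-monoʳ-≤ (4 * (s * s)) ih) ⟩
  4 * (s * s) * (16 * (X * X) + q) + 16 * (n * n) * q
    ≡⟨ regroup s X q (n * n) ⟩
  16 * ((2 * s * X) * (2 * s * X)) + 16 * (n * n) * q + 4 * (s * s) * q
    ≤⟨ +-monoˡ-≤ _ (+-monoˡ-≤ _ (*-monoʳ-≤ 16 (*-mono-≤ (excess-recurrence n) (excess-recurrence n)))) ⟩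
  16 * ((n * Y) * (n * Y)) + 16 * (n * n) * q + 4 * (s * s) * q
    ≡⟨ cong (_+ 4 * (s * s) * q) (factor n Y q) ⟩
  n * n * (16 * (Y * Y) + 16 * q) + 4 * (s * s) * q
    ∎)))
  where
  open ≤-Reasoning
  n = suc m
  s = suc (n + n)
  q = 4 ^ (n + n)
  X = excess (n + n)
  Y = excess (suc n + suc n)
  poly : ∀ m q → let n = suc m; s = suc (n + n) in
    n * n * (5 * suc n * (16 * q)) + 4 * (s * s) * q + 4 * m * q ≡ 4 * (s * s) * (5 * n * q) + 16 * (n * n) * q
  poly = solve-∀
  regroup : ∀ s X q p → 4 * (s * s) * (16 * (X * X) + q) + 16 * p * q ≡
                        16 * ((2 * s * X) * (2 * s * X)) + 16 * p * q + 4 * (s * s) * q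
  regroup = solve-∀
  factor : ∀ n Y q → 16 * ((n * Y) * (n * Y)) + 16 * (n * n) * q ≡ n * n * (16 * (Y * Y) + 16 * q)
  factor = solve-∀

-- 16·P(2n)² ≥ (5n − 1)·16ⁿ, stated without truncated subtraction.
wallis : ∀ n → 5 * n * 4 ^ (n + n) ≤ 16 * (excess (n + n) * excess (n + n)) + 4 ^ (n + n)
wallis zero          = z≤n
wallis (suc zero)    = ≤-refl
wallis (suc (suc m)) = wallis-step m (wallis (suc m))

even-or-odd : ∀ k → Σ[ n ∈ ℕ ] (k ≡ n + n ⊎ k ≡ suc (n + n))
even-or-odd zero = 0 , inj₁ refl
even-or-odd (suc k) with even-or-odd k
... | n , inj₁ k≡n+n   = n , inj₂ (cong suc k≡n+n)
... | n , inj₂ k≡1+n+n = suc n , inj₁ (trans (cong suc k≡1+n+n) (sym ([1+n]+[1+n]≡2+[n+n] n)))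

excess-square-bound : ∀ k → 5 * k * 4 ^ k ≤ 32 * (excess k * excess k) + 7 * 4 ^ k
excess-square-bound k with even-or-odd k
... | n , inj₁ refl = begin
  5 * (n + n) * q                 ≡⟨ double n q ⟩
  2 * (5 * n * q)                 ≤⟨ *-monoʳ-≤ 2 (wallis n) ⟩
  2 * (16 * (X * X) + q)          ≤⟨ m≤m+n _ (5 * q) ⟩
  2 * (16 * (X * X) + q) + 5 * q  ≡⟨ regroup X q ⟩
  32 * (X * X) + 7 * q            ∎
  where
  open ≤-Reasoning
  q = 4 ^ (n + n)
  X = excess (n + n)
  double : ∀ n q → 5 * (n + n) * q ≡ 2 * (5 * n * q)
  double = solve-∀
  regroup : ∀ X q → 2 * (16 * (X * X) + q) + 5 * q ≡ 32 * (X * X) + 7 * q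
  regroup = solve-∀
... | n , inj₂ refl = begin
  5 * suc (n + n) * (4 * q)               ≡⟨ expand n q ⟩
  8 * (5 * n * q) + 20 * q                ≤⟨ +-monoˡ-≤ (20 * q) (*-monoʳ-≤ 8 (wallis n)) ⟩
  8 * (16 * (X * X) + q) + 20 * q         ≡⟨ regroup X q ⟩
  32 * ((2 * X) * (2 * X)) + 7 * (4 * q)  ≤⟨ +-monoˡ-≤ _ (*-monoʳ-≤ 32 (*-mono-≤ 2X≤P 2X≤P)) ⟩
  32 * (P * P) + 7 * (4 * q)              ∎
  where
  open ≤-Reasoning
  q = 4 ^ (n + n)
  X = excess (n + n)
  P = excess (suc (n + n))
  2X≤P : 2 * X ≤ P
  2X≤P = excess-double-≤ (n + n)
  expand : ∀ n q → 5 * suc (n + n) * (4 * q) ≡ 8 * (5 * n * q) + 20 * q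
  expand = solve-∀
  regroup : ∀ X q → 8 * (16 * (X * X) + q) + 20 * q ≡ 32 * ((2 * X) * (2 * X)) + 7 * (4 * q)
  regroup = solve-∀


[m∸n]+[n∸m]≤[∣m-n∣∸1]+1 : ∀ m n → (m ∸ n) + (n ∸ m) ≤ (∣ m - n ∣ ∸ 1) + 1
[m∸n]+[n∸m]≤[∣m-n∣∸1]+1 zero    zero    = z≤n
[m∸n]+[n∸m]≤[∣m-n∣∸1]+1 zero    (suc n) = ≤-reflexive (+-comm 1 n)
[m∸n]+[n∸m]≤[∣m-n∣∸1]+1 (suc m) zero    = ≤-reflexive (trans (+-identityʳ (suc m)) (+-comm 1 m))
[m∸n]+[n∸m]≤[∣m-n∣∸1]+1 (suc m) (suc n) = [m∸n]+[n∸m]≤[∣m-n∣∸1]+1 m n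

excess-≤-sum-minChanges : ∀ k → 2 * excess k ≤ sumV k minChanges + 2 ^ k
excess-≤-sum-minChanges k = begin
  2 * excess k                                   ≡⟨ cong (excess k +_) (+-identityʳ (excess k)) ⟩
  excess k + excess k                            ≡⟨ cong (excess k +_) (sumCounts-swap k (λ a b → a ∸ b)) ⟩
  excess k + sumCounts k (λ a b → b ∸ a)         ≡⟨ sumCounts-+ k (λ a b → a ∸ b) (λ a b → b ∸ a) ⟨
  sumCounts k (λ a b → (a ∸ b) + (b ∸ a))        ≤⟨ sumCounts-mono k [m∸n]+[n∸m]≤[∣m-n∣∸1]+1 ⟩
  sumCounts k (λ a b → (∣ a - b ∣ ∸ 1) + 1)      ≡⟨ sumCounts-+ k (λ a b → ∣ a - b ∣ ∸ 1) (λ _ _ → 1) ⟩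
  sumV k minChanges + sumCounts k (λ _ _ → 1)    ≡⟨ cong (sumV k minChanges +_) (sumCounts-const k 1) ⟩
  sumV k minChanges + 2 ^ k * 1                  ≡⟨ cong (sumV k minChanges +_) (*-identityʳ (2 ^ k)) ⟩
  sumV k minChanges + 2 ^ k                      ∎
  where open ≤-Reasoning

2*[m*n]≤m*m+n*n : ∀ m n → 2 * (m * n) ≤ m * m + n * n
2*[m*n]≤m*m+n*n m n = [ ordered , (λ n≤m → subst₂ _≤_ (cong (2 *_) (*-comm n m)) (+-comm (n * n) (m * m)) (ordered n≤m)) ]′
  (≤-total m n)
  where
  square : ∀ a d → a * a + (a + d) * (a + d) ≡ 2 * (a * (a + d)) + d * d
  square = solve-∀
  ordered : ∀ {a b} → a ≤ b → 2 * (a * b) ≤ a * a + b * b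
  ordered {a} {b} a≤b = subst (λ b → 2 * (a * b) ≤ a * a + b * b) (m+[n∸m]≡n a≤b)
    (subst (2 * (a * (a + (b ∸ a))) ≤_) (sym (square a (b ∸ a))) (m≤m+n _ _))

bound-transfer : ∀ k T P x → 470 ≤ k → 2 * P ≤ T + x → 5 * k * (x * x) ≤ 32 * (P * P) + 7 * (x * x) →
  49 * (x * x * k) ≤ 100 * (T * T)
bound-transfer k T P x 470≤k 2P≤T+x bound = +-cancelʳ-≤ (470 * (x * x)) _ _ (begin
  49 * (x * x * k) + 470 * (x * x)         ≤⟨ +-monoʳ-≤ _ (*-monoˡ-≤ (x * x) 470≤k) ⟩
  49 * (x * x * k) + k * (x * x)           ≡⟨ e₁ k x ⟩
  10 * (5 * k * (x * x))                   ≤⟨ *-monoʳ-≤ 10 bound ⟩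
  10 * (32 * (P * P) + 7 * (x * x))        ≡⟨ e₂ P x ⟩
  80 * ((2 * P) * (2 * P)) + 70 * (x * x)  ≤⟨ +-monoˡ-≤ _ (*-monoʳ-≤ 80 (*-mono-≤ 2P≤T+x 2P≤T+x)) ⟩
  80 * ((T + x) * (T + x)) + 70 * (x * x)  ≡⟨ e₃ T x ⟩
  80 * (T * T) + 20 * (2 * (T * (4 * x))) + 150 * (x * x)
    ≤⟨ +-monoˡ-≤ _ (+-monoʳ-≤ (80 * (T * T)) (*-monoʳ-≤ 20 (2*[m*n]≤m*m+n*n T (4 * x)))) ⟩
  80 * (T * T) + 20 * (T * T + (4 * x) * (4 * x)) + 150 * (x * x)
    ≡⟨ e₄ T x ⟩
  100 * (T * T) + 470 * (x * x)            ∎)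
  where
  open ≤-Reasoning
  e₁ : ∀ k x → 49 * (x * x * k) + k * (x * x) ≡ 10 * (5 * k * (x * x))
  e₁ = solve-∀
  e₂ : ∀ P x → 10 * (32 * (P * P) + 7 * (x * x)) ≡ 80 * ((2 * P) * (2 * P)) + 70 * (x * x)
  e₂ = solve-∀
  e₃ : ∀ T x → 80 * ((T + x) * (T + x)) + 70 * (x * x) ≡ 80 * (T * T) + 20 * (2 * (T * (4 * x))) + 150 * (x * x)
  e₃ = solve-∀
  e₄ : ∀ T x → 80 * (T * T) + 20 * (T * T + (4 * x) * (4 * x)) + 150 * (x * x) ≡ 100 * (T * T) + 470 * (x * x)
  e₄ = solve-∀

4^k≡2^k*2^k : ∀ k → 4 ^ k ≡ 2 ^ k * 2 ^ k
4^k≡2^k*2^k zero    = refl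
4^k≡2^k*2^k (suc k) = trans (cong (4 *_) (4^k≡2^k*2^k k)) (regroup (2 ^ k))
  where
  regroup : ∀ y → 4 * (y * y) ≡ (2 * y) * (2 * y)
  regroup = solve-∀

sum-minChanges-bound : ∀ k → 470 ≤ k → 49 * (4 ^ k * k) ≤ 100 * (sumV k minChanges * sumV k minChanges)
sum-minChanges-bound k 470≤k = subst (λ p → 49 * (p * k) ≤ 100 * (T * T)) (sym (4^k≡2^k*2^k k))
  (bound-transfer k T (excess k) (2 ^ k) 470≤k (excess-≤-sum-minChanges k)
    (subst (λ p → 5 * k * p ≤ 32 * (excess k * excess k) + 7 * p) (4^k≡2^k*2^k k) (excess-square-bound k)))
  where T = sumV k minChanges

lemma5 : Σ ℕ (λ K → ∀ k → K ≤ k →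
           Σ (Coloring k) (λ c → Σ (Vertex k → ℕ) (λ s →
             (∀ u → IsMinChanges c u (complement u) (s u))
             × 49 * (4 ^ k * k) ≤ 100 * (sumV k s * sumV k s))))
lemma5 = 470 , λ k 470≤k →
  parityColouring k , minChanges , minChanges-parityColouring , sum-minChanges-bound k 470≤k
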